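{- There are no finite vertex-transitive graphs whose motion is $3$. More precisely, if the automorphism group of a finite graph contains a $3$-cycle, then its automorphism group has minimal degree $2$.
   Context: Graphs are finite, simple, undirected. The minimal degree of a permutation group is the minimum number of points moved by a non-identity element; the motion of a graph is the minimal degree of its automorphism group acting on vertices. -}

module Defs where

open import Data.Nat using (ℕ; _≤_)
open import Data.Bool using (Bool; false)
open import Data.Fin using (Fin; _≟_)
open import Data.Fin.Permutation using (Permutation′; _⟨$⟩ʳ_)
open import Data.List using (length; filter; allFin)
open import Data.Product using (Σ; ∃; _×_)
open import Relation.Nullary using (¬_; ¬?)
open import Relation.Binary.PropositionalEquality using (_≡_; _≢_)

record Graph (n : ℕ) : Set where
  field
    adj   : Fin n → Fin n → Bool
    sym   : ∀ i j → adj i j ≡ adj j i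
    irrefl : ∀ i → adj i i ≡ false
open Graph public

IsAutomorphism : ∀ {n} → Graph n → Permutation′ n → Set
IsAutomorphism G σ = ∀ i j → adj G (σ ⟨$⟩ʳ i) (σ ⟨$⟩ʳ j) ≡ adj G i j

degree : ∀ {n} → Permutation′ n → ℕ
degree {n} σ = length (filter (λ x → ¬? ((σ ⟨$⟩ʳ x) ≟ x)) (allFin n))

NonIdentity : ∀ {n} → Permutation′ n → Set
NonIdentity σ = ∃ λ x → σ ⟨$⟩ʳ x ≢ x

Is3Cycle : ∀ {n} → Permutation′ n → Set
Is3Cycle {n} σ = Σ (Fin n) λ a → Σ (Fin n) λ b → Σ (Fin n) λ c →
  a ≢ b × b ≢ c × a ≢ c ×
  σ ⟨$⟩ʳ a ≡ b × σ ⟨$⟩ʳ b ≡ c × σ ⟨$⟩ʳ c ≡ a ×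
  (∀ x → x ≢ a → x ≢ b → x ≢ c → σ ⟨$⟩ʳ x ≡ x)

AutHas3Cycle : ∀ {n} → Graph n → Set
AutHas3Cycle G = ∃ λ σ → IsAutomorphism G σ × Is3Cycle σ

MinimalDegreeAut : ∀ {n} → Graph n → ℕ → Set
MinimalDegreeAut G d =
  (∃ λ σ → IsAutomorphism G σ × NonIdentity σ × degree σ ≡ d) ×
  (∀ σ → IsAutomorphism G σ → NonIdentity σ → d ≤ degree σ)

{-# OPTIONS --safe #-}
module Submission where

-- An automorphism σ = (a b c) sends the pair {a, x} to {b, x} for x ∉ {a, b, c}, and
-- {c, a} to {b, c}; so a and b are twins: they have the same neighbours outside {a, b}.
-- Swapping two twins is an automorphism moving exactly two points, and no non-identity
-- permutation moves fewer than two.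

open import Defs renaming (sym to adj-sym)
open import Data.Nat using (ℕ; _≤_; z≤n; s≤s)
open import Data.Nat.Properties using (≤-antisym)
open import Data.Fin using (Fin; _≟_)
open import Data.Fin.Permutation using (Permutation′; _⟨$⟩ʳ_; transpose)
open import Data.List using (List; []; _∷_; length; filter; allFin)
open import Data.List.Membership.Propositional using (_∈_)
open import Data.List.Membership.Propositional.Properties using (∈-filter⁺; ∈-allFin)
open import Data.List.Relation.Unary.All as All using (All; _∷_)
open import Data.List.Relation.Unary.All.Properties using (all-filter)
open import Data.List.Relation.Unary.AllPairs using (_∷_)
open import Data.List.Relation.Unary.Any using (here; there)
open import Data.List.Relation.Unary.Unique.Propositional using (Unique)
open import Data.List.Relation.Unary.Unique.Propositional.Properties using (filter⁺; allFin⁺)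
open import Data.Product using (_,_)
open import Data.Sum using (_⊎_; inj₁; inj₂)
open import Data.Empty using (⊥; ⊥-elim)
open import Function using (_∘_; Injection)
open import Function.Properties.Inverse using (↔⇒↣)
open import Relation.Nullary using (yes; no; ¬?; contradiction)
open import Relation.Unary using (Decidable)
open import Relation.Binary.PropositionalEquality
  using (_≡_; _≢_; refl; sym; trans; cong₂; module ≡-Reasoning)

private
  variable
    n : ℕ
    A : Set
    a b c i i′ j j′ x x′ y z : A
    xs : List A

2≤length : x ≢ y → x ∈ xs → y ∈ xs → 2 ≤ length xs
2≤length {xs = _ ∷ _ ∷ _} _   _           _           = s≤s (s≤s z≤n)
2≤length {xs = _ ∷ []}    x≢y (here refl) (here refl) = contradiction refl x≢y
2≤length {xs = _ ∷ []}    _   (there ())  _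
2≤length {xs = _ ∷ []}    _   _           (there ())

pairwise-distinct-in-pair : x ≢ y → x ≢ z → y ≢ z →
  x ≡ a ⊎ x ≡ b → y ≡ a ⊎ y ≡ b → z ≡ a ⊎ z ≡ b → ⊥
pairwise-distinct-in-pair x≢y _   _   (inj₁ refl) (inj₁ refl) _           = x≢y refl
pairwise-distinct-in-pair x≢y _   _   (inj₂ refl) (inj₂ refl) _           = x≢y refl
pairwise-distinct-in-pair _   x≢z _   (inj₁ refl) (inj₂ refl) (inj₁ refl) = x≢z refl
pairwise-distinct-in-pair _   _   y≢z (inj₁ refl) (inj₂ refl) (inj₂ refl) = y≢z refl
pairwise-distinct-in-pair _   _   y≢z (inj₂ refl) (inj₁ refl) (inj₁ refl) = y≢z refl
pairwise-distinct-in-pair _   x≢z _   (inj₂ refl) (inj₁ refl) (inj₂ refl) = x≢z refl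

length≤2 : Unique xs → All (λ x → x ≡ a ⊎ x ≡ b) xs → length xs ≤ 2
length≤2 {xs = []}              _ _ = z≤n
length≤2 {xs = _ ∷ []}          _ _ = s≤s z≤n
length≤2 {xs = _ ∷ _ ∷ []}      _ _ = s≤s (s≤s z≤n)
length≤2 {xs = _ ∷ _ ∷ _ ∷ _} ((x≢y ∷ x≢z ∷ _) ∷ (y≢z ∷ _) ∷ _) (x∈ ∷ y∈ ∷ z∈ ∷ _) =
  ⊥-elim (pairwise-distinct-in-pair x≢y x≢z y≢z x∈ y∈ z∈)

moved? : (σ : Permutation′ n) → Decidable (λ x → σ ⟨$⟩ʳ x ≢ x)
moved? σ x = ¬? (σ ⟨$⟩ʳ x ≟ x)

2≤degree : (σ : Permutation′ n) → x ≢ y → σ ⟨$⟩ʳ x ≢ x → σ ⟨$⟩ʳ y ≢ y → 2 ≤ degree σ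
2≤degree σ x≢y σx≢x σy≢y =
  2≤length x≢y (∈-filter⁺ (moved? σ) (∈-allFin _) σx≢x) (∈-filter⁺ (moved? σ) (∈-allFin _) σy≢y)

degree≤2 : (σ : Permutation′ n) → (∀ {x} → σ ⟨$⟩ʳ x ≢ x → x ≡ a ⊎ x ≡ b) → degree σ ≤ 2
degree≤2 σ moved⇒a∨b =
  length≤2 (filter⁺ (moved? σ) (allFin⁺ _)) (All.map moved⇒a∨b (all-filter (moved? σ) (allFin _)))

nonIdentity⇒2≤degree : (σ : Permutation′ n) → NonIdentity σ → 2 ≤ degree σ
nonIdentity⇒2≤degree σ (x , σx≢x) = 2≤degree σ (σx≢x ∘ sym) σx≢x σσx≢σx
  where
  σσx≢σx : σ ⟨$⟩ʳ (σ ⟨$⟩ʳ x) ≢ σ ⟨$⟩ʳ x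
  σσx≢σx = σx≢x ∘ Injection.injective (↔⇒↣ σ)

data Transposed (a b : Fin n) : Fin n → Fin n → Set where
  swap-a : Transposed a b a b
  swap-b : Transposed a b b a
  fixed  : x ≢ a → x ≢ b → Transposed a b x x

transposed : (a b x : Fin n) → Transposed a b x (transpose a b ⟨$⟩ʳ x)
transposed a b x with x ≟ a
... | yes refl = swap-a
... | no x≢a with x ≟ b
...   | yes refl = swap-b
...   | no x≢b = fixed x≢a x≢b

transposed-moved⇒∈pair : Transposed a b x x′ → x′ ≢ x → x ≡ a ⊎ x ≡ b
transposed-moved⇒∈pair swap-a      _   = inj₁ refl
transposed-moved⇒∈pair swap-b      _   = inj₂ refl
transposed-moved⇒∈pair (fixed _ _) x≢x = contradiction refl x≢x

∈pair⇒transposed-moved : a ≢ b → Transposed a b x x′ → x ≡ a ⊎ x ≡ b → x′ ≢ x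
∈pair⇒transposed-moved a≢b swap-a          _          = a≢b ∘ sym
∈pair⇒transposed-moved a≢b swap-b          _          = a≢b
∈pair⇒transposed-moved _   (fixed x≢a _)   (inj₁ x≡a) = contradiction x≡a x≢a
∈pair⇒transposed-moved _   (fixed _   x≢b) (inj₂ x≡b) = contradiction x≡b x≢b

degree-transpose : a ≢ b → degree (transpose a b) ≡ 2
degree-transpose {a = a} {b = b} a≢b = ≤-antisym
  (degree≤2 (transpose a b) (λ {x} → transposed-moved⇒∈pair (transposed a b x)))
  (2≤degree (transpose a b) a≢b
    (∈pair⇒transposed-moved a≢b (transposed a b a) (inj₁ refl))
    (∈pair⇒transposed-moved a≢b (transposed a b b) (inj₂ refl)))

Twins : Graph n → Fin n → Fin n → Set
Twins G a b = ∀ x → x ≢ a → x ≢ b → adj G a x ≡ adj G b x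

module _ (G : Graph n) {a b : Fin n} (twins : Twins G a b) where

  adj-transposedˡ : Transposed a b i i′ → j ≢ a → j ≢ b → adj G i′ j ≡ adj G i j
  adj-transposedˡ swap-a      j≢a j≢b = sym (twins _ j≢a j≢b)
  adj-transposedˡ swap-b      j≢a j≢b = twins _ j≢a j≢b
  adj-transposedˡ (fixed _ _) _   _   = refl

  adj-transposed : Transposed a b i i′ → Transposed a b j j′ → adj G i′ j′ ≡ adj G i j
  adj-transposed swap-a          swap-a          = trans (irrefl G b) (sym (irrefl G a))
  adj-transposed swap-a          swap-b          = adj-sym G b a
  adj-transposed swap-b          swap-a          = adj-sym G a b
  adj-transposed swap-b          swap-b          = trans (irrefl G a) (sym (irrefl G b))
  adj-transposed u               (fixed j≢a j≢b) = adj-transposedˡ u j≢a j≢b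
  adj-transposed (fixed i≢a i≢b) v               =
    trans (adj-sym G _ _) (trans (adj-transposedˡ v i≢a i≢b) (adj-sym G _ _))

  transpose-twins-isAutomorphism : IsAutomorphism G (transpose a b)
  transpose-twins-isAutomorphism i j = adj-transposed (transposed a b i) (transposed a b j)

open ≡-Reasoning

3-cycle⇒twins : (G : Graph n) (σ : Permutation′ n) → IsAutomorphism G σ →
  σ ⟨$⟩ʳ a ≡ b → σ ⟨$⟩ʳ b ≡ c → σ ⟨$⟩ʳ c ≡ a →
  (∀ x → x ≢ a → x ≢ b → x ≢ c → σ ⟨$⟩ʳ x ≡ x) → Twins G a b
3-cycle⇒twins {a = a} {b = b} {c = c} G σ aut σa σb σc fixes x x≢a x≢b with x ≟ c
... | yes refl = begin
  adj G a x                   ≡⟨ cong₂ (adj G) σc σb ⟨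
  adj G (σ ⟨$⟩ʳ x) (σ ⟨$⟩ʳ b) ≡⟨ aut x b ⟩
  adj G x b                   ≡⟨ adj-sym G x b ⟩
  adj G b x                   ∎
... | no x≢c = begin
  adj G a x                   ≡⟨ aut a x ⟨
  adj G (σ ⟨$⟩ʳ a) (σ ⟨$⟩ʳ x) ≡⟨ cong₂ (adj G) σa (fixes x x≢a x≢b x≢c) ⟩
  adj G b x                   ∎

corollary3p4 : ∀ (n : ℕ) (G : Graph n) → AutHas3Cycle G → MinimalDegreeAut G 2
corollary3p4 n G (σ , aut , a , b , c , a≢b , _ , _ , σa , σb , σc , fixes) =
  ( transpose a b
  , transpose-twins-isAutomorphism G (3-cycle⇒twins G σ aut σa σb σc fixes)
  , (a , ∈pair⇒transposed-moved a≢b (transposed a b a) (inj₁ refl))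
  , degree-transpose a≢b )
  , λ π _ → nonIdentity⇒2≤degree π
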